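{- Let $k\geq 1$ and let $X$ be an extremal undirected circulant graph of degree $4$ and diameter $k$ (up to isomorphism, $X=X(\mathbb{Z}_n,\{\pm 1,\pm(2k+1)\})$ with $n=2k^2+2k+1$). Then the odd girth of $X$ is $2k+1$.
   Context: An undirected circulant graph $X(\mathbb{Z}_n,C)$ has vertex set $\mathbb{Z}_n$, with $i,j$ adjacent iff $j-i\in C$, where $C\subseteq\mathbb{Z}_n\setminus\{0\}$ is inverse-closed; its degree is $|C|$. An extremal circulant graph of degree $d$ and diameter $k$ is one of maximum order among circulant graphs of degree $d$ and diameter $k$; for $d=4$ it is known (Chen–Jia) that this maximum order is $2k^2+2k+1$ and the extremal graph is unique up to isomorphism, given by the generator set $\{1,2k+1\}$. The odd girth of a graph is the length of its shortest cycle of odd length. -}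

module Defs where

open import Data.Nat using (ℕ; zero; suc; _+_; _*_; _∸_; _≤_; _<_; NonZero)
open import Data.Nat.DivMod using (_%_)
open import Data.Fin using (Fin; toℕ)
open import Data.List using (List; _∷_; [])
open import Data.List.Membership.Propositional using (_∈_)
open import Data.Product using (Σ; _×_; ∃)
open import Relation.Binary.PropositionalEquality using (_≡_)

-- Circulant graph X(ℤ_n, C): vertices ℤ_n (as Fin n), C a list of residues
-- (naturals, read mod n); i ~ j  iff  j - i ≡ c (mod n) for some c ∈ C,
-- i.e. (i + c) mod n = j.
CircAdj : (n : ℕ) .{{_ : NonZero n}} → List ℕ → Fin n → Fin n → Set
CircAdj n C i j = Σ ℕ λ c → c ∈ C × ((toℕ i + c) % n ≡ toℕ j)

IsCycle : {V : Set} → (V → V → Set) → ℕ → (ℕ → V) → Set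
IsCycle {V} Adj L v =
  (3 ≤ L) ×
  (v L ≡ v 0) ×
  (∀ i → i < L → Adj (v i) (v (suc i))) ×
  (∀ i j → i < L → j < L → v i ≡ v j → i ≡ j)

Odd : ℕ → Set
Odd L = ∃ λ m → L ≡ suc (2 * m)

OddGirth : {V : Set} → (V → V → Set) → ℕ → Set
OddGirth {V} Adj g =
  (Odd g × ∃ λ (v : ℕ → V) → IsCycle Adj g v) ×
  (∀ (L : ℕ) (v : ℕ → V) → IsCycle Adj L v → Odd L → g ≤ L)

extOrder : ℕ → ℕ
extOrder k = suc (2 * k * k + 2 * k)

-- generator set {±1, ±(2k+1)} as residues mod n = extOrder k
extGens : ℕ → List ℕ
extGens k = 1 ∷ (extOrder k ∸ 1) ∷ (2 * k + 1) ∷ (extOrder k ∸ (2 * k + 1)) ∷ []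

ExtAdj : (k : ℕ) → Fin (extOrder k) → Fin (extOrder k) → Set
ExtAdj k = CircAdj (extOrder k) (extGens k)

-- Write m = 2k+1 and n = 2k²+2k+1.  A closed walk in X(ℤₙ, {±1, ±m}) with a steps +1,
-- b steps +m, c steps −1 and d steps −m has a + bm ≡ c + dm (mod n), so after possibly
-- swapping the two sides a + bm = c + dm + tn, and its length is L = a + b + c + d.
-- If t = 0 then L ≡ a + bm + c + dm ≡ 0 (mod 2) because m is odd.  If t ≥ 2 then
-- 2n ≤ a + bm ≤ Lm, so L > 2k.  If t = 1, cancel common ±m steps: when d = 0 and b ≤ k a
-- walk of length ≤ 2k has a + bm < n, and when b ≥ k+1 it needs c ≥ (k+1)m − n = k.
-- Conversely k steps +m followed by k+1 steps +1 run through
-- 0 < m < 2m < … < km < km+1 < … < km+k+1 = n ≡ 0, an odd cycle of length m.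
module Submission where

open import Defs
open import Data.Nat using (ℕ; zero; suc; _+_; _*_; _∸_; _≤_; _<_; _⊓_; z≤n; s≤s; NonZero; _≤?_; _<?_; z<s)
open import Data.Nat.Properties
open import Data.Nat.DivMod using (_%_; _/_; _mod_; m≡m%n+[m/n]*n; %-distribˡ-+; m%n%n≡m%n; n%n≡0; m<n⇒m%n≡m)
open import Data.Nat.Tactic.RingSolver using (solve-∀)
open import Data.Fin using (Fin; toℕ)
open import Data.Fin.Properties using (toℕ-fromℕ<; toℕ-injective)
open import Data.List.Relation.Unary.Any using (here; there)
open import Data.List.Membership.Propositional using (_∈_)
open import Data.Product using (∃; _×_; _,_)
open import Data.Sum using (_⊎_; inj₁; inj₂)
open import Data.Empty using (⊥-elim)
open import Relation.Nullary using (¬_; yes; no)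
open import Relation.Binary.PropositionalEquality

module _ {n : ℕ} .{{_ : NonZero n}} where

  %-+-cong : ∀ {a b c d} → a % n ≡ b % n → c % n ≡ d % n → (a + c) % n ≡ (b + d) % n
  %-+-cong {a} {b} {c} {d} a≡b c≡d = begin
    (a + c) % n         ≡⟨ %-distribˡ-+ a c n ⟩
    (a % n + c % n) % n ≡⟨ cong₂ (λ x y → (x + y) % n) a≡b c≡d ⟩
    (b % n + d % n) % n ≡⟨ %-distribˡ-+ b d n ⟨
    (b + d) % n         ∎
    where open ≡-Reasoning

  ≤-quotient⇒differ-by-multiple : ∀ a b → a % n ≡ b % n → b / n ≤ a / n → a ≡ b + (a / n ∸ b / n) * n
  ≤-quotient⇒differ-by-multiple a b a≡b q≤ = begin
    a                          ≡⟨ m≡m%n+[m/n]*n a n ⟩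
    a % n + a / n * n          ≡⟨ cong₂ (λ r q → r + q * n) a≡b (sym (m+[n∸m]≡n q≤)) ⟩
    b % n + (b / n + t) * n    ≡⟨ cong (b % n +_) (*-distribʳ-+ n (b / n) t) ⟩
    b % n + (b / n * n + t * n) ≡⟨ +-assoc (b % n) (b / n * n) (t * n) ⟨
    b % n + b / n * n + t * n  ≡⟨ cong (_+ t * n) (m≡m%n+[m/n]*n b n) ⟨
    b + t * n                  ∎
    where
    open ≡-Reasoning
    t = a / n ∸ b / n

  %≡%⇒differ-by-multiple : ∀ a b → a % n ≡ b % n → ∃ λ t → a ≡ b + t * n ⊎ b ≡ a + t * n
  %≡%⇒differ-by-multiple a b a≡b with ≤-total (b / n) (a / n)
  ... | inj₁ q≤ = a / n ∸ b / n , inj₁ (≤-quotient⇒differ-by-multiple a b a≡b q≤)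
  ... | inj₂ q≥ = b / n ∸ a / n , inj₂ (≤-quotient⇒differ-by-multiple b a (sym a≡b) q≥)

  wraps-around : ∀ c → c ≤ n → (n ∸ c + c) % n ≡ 0
  wraps-around c c≤n = trans (cong (_% n) (m∸n+n≡m c≤n)) (n%n≡0 n)

  %-walk-step : ∀ {x y c F B F′ B′ y′} → (x + F) % n ≡ (y + B) % n → (y + c) % n ≡ y′ →
                (c + B′) % n ≡ F′ % n → (x + (F + F′)) % n ≡ (y′ + (B + B′)) % n
  %-walk-step {x} {y} {c} {F} {B} {F′} {B′} {y′} x≡y y+c≡y′ c≡F′ = begin
    (x + (F + F′)) % n       ≡⟨ cong (_% n) (+-assoc x F F′) ⟨
    (x + F + F′) % n         ≡⟨ %-+-cong x≡y (sym c≡F′) ⟩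
    (y + B + (c + B′)) % n   ≡⟨ cong (_% n) (exchange y B c B′) ⟩
    (y + c + (B + B′)) % n   ≡⟨ %-+-cong (trans (sym (m%n%n≡m%n (y + c) n)) (cong (_% n) y+c≡y′)) refl ⟩
    (y′ + (B + B′)) % n      ∎
    where
    open ≡-Reasoning
    exchange : ∀ y B c B′ → y + B + (c + B′) ≡ y + c + (B + B′)
    exchange = solve-∀

x+y≡x+z+w⇒y≡z+w : ∀ x y z {w} → x + y ≡ x + z + w → y ≡ z + w
x+y≡x+z+w⇒y≡z+w x y z {w} eq = +-cancelˡ-≡ x y (z + w) (trans eq (+-assoc x z w))

balanced⇒¬odd : ∀ j a b c d → a + b * (2 * j + 1) ≡ c + d * (2 * j + 1) → ¬ Odd (a + b + c + d)
balanced⇒¬odd j a b c d eq (x , odd) = even≢odd (c + d * (2 * j + 1)) (x + j * (b + d)) (begin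
  2 * (c + d * (2 * j + 1))                         ≡⟨ double (c + d * (2 * j + 1)) ⟩
  (c + d * (2 * j + 1)) + (c + d * (2 * j + 1))     ≡⟨ cong (_+ (c + d * (2 * j + 1))) eq ⟨
  (a + b * (2 * j + 1)) + (c + d * (2 * j + 1))     ≡⟨ regroup j a b c d ⟩
  (a + b + c + d) + 2 * (j * (b + d))               ≡⟨ cong (_+ 2 * (j * (b + d))) odd ⟩
  suc (2 * x) + 2 * (j * (b + d))                   ≡⟨ collect x j b d ⟩
  suc (2 * (x + j * (b + d)))                       ∎)
  where
  open ≡-Reasoning
  double : ∀ y → 2 * y ≡ y + y
  double = solve-∀
  regroup : ∀ j a b c d → (a + b * (2 * j + 1)) + (c + d * (2 * j + 1)) ≡ (a + b + c + d) + 2 * (j * (b + d))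
  regroup = solve-∀
  collect : ∀ x j b d → suc (2 * x) + 2 * (j * (b + d)) ≡ suc (2 * (x + j * (b + d)))
  collect = solve-∀

record Tally : Set where
  constructor tally
  field
    up₁ upₘ down₁ downₘ : ℕ

size : Tally → ℕ
size (tally a b c d) = a + b + c + d

_⊕_ : Tally → Tally → Tally
tally a b c d ⊕ tally a′ b′ c′ d′ = tally (a + a′) (b + b′) (c + c′) (d + d′)

size-⊕ : ∀ s t → size (s ⊕ t) ≡ size s + size t
size-⊕ (tally a b c d) (tally a′ b′ c′ d′) = regroup a b c d a′ b′ c′ d′
  where
  regroup : ∀ a b c d a′ b′ c′ d′ →
            (a + a′) + (b + b′) + (c + c′) + (d + d′) ≡ (a + b + c + d) + (a′ + b′ + c′ + d′)
  regroup = solve-∀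

module _ (k : ℕ) where

  private
    m n : ℕ
    m = 2 * k + 1
    n = extOrder k

  <m⇒≤2k : ∀ {x} → x < m → x ≤ 2 * k
  <m⇒≤2k {x} x<m = ≤-pred (subst (suc x ≤_) (+-comm (2 * k) 1) x<m)

  m≤n : m ≤ n
  m≤n = subst (_≤ n) (+-comm 1 (2 * k)) (s≤s (m≤n+m (2 * k) (2 * k * k)))

  wrap-without-descent : ∀ a b c → a + b * m ≡ c + n → m ≤ a + b + c
  wrap-without-descent a b c eq with b ≤? k
  ... | yes b≤k = ≮⇒≥ λ short → <-irrefl refl (begin-strict
    a + b * m               ≡⟨ split-m a b k ⟩
    (a + b) + b * (2 * k)   ≤⟨ +-mono-≤ (<m⇒≤2k (≤-trans (s≤s (m≤m+n (a + b) c)) short))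
                                        (*-monoˡ-≤ (2 * k) b≤k) ⟩
    2 * k + k * (2 * k)     ≡⟨ bound k ⟩
    2 * k * k + 2 * k       <⟨ n<1+n _ ⟩
    n                       ≤⟨ m≤n+m n c ⟩
    c + n                   ≡⟨ eq ⟨
    a + b * m               ∎)
    where
    open ≤-Reasoning
    split-m : ∀ a b k → a + b * (2 * k + 1) ≡ (a + b) + b * (2 * k)
    split-m = solve-∀
    bound : ∀ k → 2 * k + k * (2 * k) ≡ 2 * k * k + 2 * k
    bound = solve-∀
  ... | no b≰k = begin
    m             ≡⟨ halves k ⟩
    suc k + k     ≤⟨ +-mono-≤ k<b k≤c ⟩
    b + c         ≤⟨ m≤n+m (b + c) a ⟩
    a + (b + c)   ≡⟨ +-assoc a b c ⟨
    a + b + c     ∎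
    where
    open ≤-Reasoning
    halves : ∀ k → 2 * k + 1 ≡ suc k + k
    halves = solve-∀
    overshoot : ∀ k → suc k * (2 * k + 1) ≡ suc (2 * k * k + 2 * k) + k
    overshoot = solve-∀
    k<b : k < b
    k<b = ≰⇒> b≰k
    k≤c : k ≤ c
    k≤c = +-cancelˡ-≤ n k c (begin
      n + k      ≡⟨ overshoot k ⟨
      suc k * m  ≤⟨ *-monoˡ-≤ m k<b ⟩
      b * m      ≤⟨ m≤n+m (b * m) a ⟩
      a + b * m  ≡⟨ eq ⟩
      c + n      ≡⟨ +-comm c n ⟩
      n + c      ∎)

  single-wrap : ∀ a b c d → a + b * m ≡ c + d * m + n → m ≤ a + b + c + d
  single-wrap a b c zero eq =
    ≤-trans (wrap-without-descent a b c (trans eq (cong (_+ n) (+-identityʳ c)))) (m≤m+n (a + b + c) 0)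
  single-wrap a zero c (suc d) eq = begin
    m                         ≤⟨ m≤n ⟩
    n                         ≤⟨ m≤n+m n _ ⟩
    c + suc d * m + n         ≡⟨ eq ⟨
    a + 0                     ≤⟨ m≤m+n (a + 0) (c + suc d) ⟩
    a + 0 + (c + suc d)       ≡⟨ +-assoc (a + 0) c (suc d) ⟨
    a + 0 + c + suc d         ∎
    where open ≤-Reasoning
  single-wrap a (suc b) c (suc d) eq = begin
    m                         ≤⟨ single-wrap a b c d (+-cancelˡ-≡ m _ _ common-step) ⟩
    a + b + c + d             ≤⟨ m≤n+m _ 2 ⟩
    2 + (a + b + c + d)       ≡⟨ two-more a b c d ⟩
    a + suc b + c + suc d     ∎
    where
    open ≤-Reasoning
    pull-left : ∀ a b m → a + (m + b * m) ≡ m + (a + b * m)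
    pull-left = solve-∀
    pull-right : ∀ c d m n → c + (m + d * m) + n ≡ m + (c + d * m + n)
    pull-right = solve-∀
    two-more : ∀ a b c d → 2 + (a + b + c + d) ≡ a + suc b + c + suc d
    two-more = solve-∀
    common-step : m + (a + b * m) ≡ m + (c + d * m + n)
    common-step = trans (sym (pull-left a b m)) (trans eq (pull-right c d m n))

  multiple-wrap : ∀ a b c d t → a + b * m ≡ c + d * m + (2 + t) * n → m ≤ a + b + c + d
  multiple-wrap a b c d t eq = ≮⇒≥ λ short → <-irrefl refl (begin-strict
    a + b * m                                  ≤⟨ m≤m+n _ _ ⟩
    a + b * m + (a * (2 * k) + (c + d) * m)    ≡⟨ spread a b c d k ⟨
    (a + b + c + d) * m                        ≤⟨ *-monoˡ-≤ m (<m⇒≤2k short) ⟩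
    2 * k * m                                  <⟨ m<m+n _ z<s ⟩
    2 * k * m + suc (suc (2 * k))              ≡⟨ twice-n k ⟩
    2 * n                                      ≤⟨ *-monoˡ-≤ n (s≤s (s≤s (z≤n {t}))) ⟩
    (2 + t) * n                                ≤⟨ m≤n+m _ _ ⟩
    c + d * m + (2 + t) * n                    ≡⟨ eq ⟨
    a + b * m                                  ∎)
    where
    open ≤-Reasoning
    spread : ∀ a b c d k →
             (a + b + c + d) * (2 * k + 1) ≡ a + b * (2 * k + 1) + (a * (2 * k) + (c + d) * (2 * k + 1))
    spread = solve-∀
    twice-n : ∀ k → 2 * k * (2 * k + 1) + suc (suc (2 * k)) ≡ 2 * suc (2 * k * k + 2 * k)
    twice-n = solve-∀

  odd-wrap-long : ∀ a b c d t → a + b * m ≡ c + d * m + t * n → Odd (a + b + c + d) → m ≤ a + b + c + d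
  odd-wrap-long a b c d zero eq odd =
    ⊥-elim (balanced⇒¬odd k a b c d (trans eq (+-identityʳ _)) odd)
  odd-wrap-long a b c d (suc zero) eq _ =
    single-wrap a b c d (trans eq (cong (c + d * m +_) (+-identityʳ n)))
  odd-wrap-long a b c d (suc (suc t)) eq _ = multiple-wrap a b c d t eq

  forward backward : Tally → ℕ
  forward (tally a b _ _) = a + b * m
  backward (tally _ _ c d) = c + d * m

  private
    interleave : ∀ a b a′ b′ → (a + a′) + (b + b′) * m ≡ (a + b * m) + (a′ + b′ * m)
    interleave a b a′ b′ = regroup a b a′ b′ m
      where
      regroup : ∀ a b a′ b′ m → (a + a′) + (b + b′) * m ≡ (a + b * m) + (a′ + b′ * m)
      regroup = solve-∀

  forward-⊕ : ∀ s t → forward (s ⊕ t) ≡ forward s + forward t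
  forward-⊕ (tally a b _ _) (tally a′ b′ _ _) = interleave a b a′ b′

  backward-⊕ : ∀ s t → backward (s ⊕ t) ≡ backward s + backward t
  backward-⊕ (tally _ _ c d) (tally _ _ c′ d′) = interleave c d c′ d′

  generator-tally : ∀ {c} → c ∈ extGens k →
                    ∃ λ δ → size δ ≡ 1 × (c + backward δ) % n ≡ forward δ % n
  generator-tally (here refl)                      = tally 1 0 0 0 , refl , refl
  generator-tally (there (here refl))              = tally 0 0 1 0 , refl , wraps-around {n} 1 (s≤s z≤n)
  generator-tally (there (there (here refl)))      = tally 0 1 0 0 , refl , refl
  generator-tally (there (there (there (here refl)))) =
    tally 0 0 0 1 , refl , trans (cong (λ x → (n ∸ m + x) % n) (+-identityʳ m)) (wraps-around {n} m m≤n)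
  generator-tally (there (there (there (there ()))))

  Reaches : (ℕ → Fin n) → ℕ → Tally → Set
  Reaches v j t = size t ≡ j × (toℕ (v 0) + forward t) % n ≡ (toℕ (v j) + backward t) % n

  walk-tally : ∀ {L} (v : ℕ → Fin n) → (∀ i → i < L → ExtAdj k (v i) (v (suc i))) →
               ∀ j → j ≤ L → ∃ (Reaches v j)
  walk-tally v adj zero _ = tally 0 0 0 0 , refl , refl
  walk-tally v adj (suc j) j<L with walk-tally v adj j (<⇒≤ j<L) | adj j j<L
  ... | t , t-size , t-reach | c , c∈ , c-step with generator-tally c∈
  ... | δ , δ-size , δ-mod = t ⊕ δ , size-step , reach-step
    where
    size-step : size (t ⊕ δ) ≡ suc j
    size-step = trans (size-⊕ t δ) (trans (cong₂ _+_ t-size δ-size) (+-comm j 1))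
    reach-step : (toℕ (v 0) + forward (t ⊕ δ)) % n ≡ (toℕ (v (suc j)) + backward (t ⊕ δ)) % n
    reach-step = subst₂ (λ F B → (toℕ (v 0) + F) % n ≡ (toℕ (v (suc j)) + B) % n)
      (sym (forward-⊕ t δ)) (sym (backward-⊕ t δ))
      (%-walk-step {n} {toℕ (v 0)} {toℕ (v j)} {c} {forward t} {backward t} {forward δ} {backward δ}
        t-reach c-step δ-mod)

  closed-walk-tally : ∀ {L v} → IsCycle (ExtAdj k) L v →
                      ∃ λ t → size t ≡ L ×
                              ∃ λ s → forward t ≡ backward t + s * n ⊎ backward t ≡ forward t + s * n
  closed-walk-tally {L} {v} (_ , closed , adj , _) with walk-tally v adj L ≤-refl
  ... | t , t-size , t-reach
    with %≡%⇒differ-by-multiple (toℕ (v 0) + forward t) (toℕ (v 0) + backward t)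
           (trans t-reach (cong (λ w → (toℕ w + backward t) % n) closed))
  ... | s , inj₁ eq = t , t-size , s , inj₁ (x+y≡x+z+w⇒y≡z+w (toℕ (v 0)) (forward t) (backward t) eq)
  ... | s , inj₂ eq = t , t-size , s , inj₂ (x+y≡x+z+w⇒y≡z+w (toℕ (v 0)) (backward t) (forward t) eq)

  odd-cycle-long : ∀ {L v} → IsCycle (ExtAdj k) L v → Odd L → m ≤ L
  odd-cycle-long cycle odd with closed-walk-tally cycle
  ... | tally a b c d , refl , s , inj₁ eq = odd-wrap-long a b c d s eq odd
  ... | tally a b c d , refl , s , inj₂ eq =
    subst (m ≤_) (rotate c d a b) (odd-wrap-long c d a b s eq (subst Odd (sym (rotate c d a b)) odd))
    where
    rotate : ∀ c d a b → c + d + a + b ≡ a + b + c + d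
    rotate = solve-∀

  cycle-vertex : ℕ → ℕ
  cycle-vertex i = i + 2 * k * (i ⊓ k)

  cycle-vertex-strictMono : ∀ {i j} → i < j → cycle-vertex i < cycle-vertex j
  cycle-vertex-strictMono i<j = +-mono-<-≤ i<j (*-monoʳ-≤ (2 * k) (⊓-monoˡ-≤ k (<⇒≤ i<j)))

  cycle-vertex-injective : ∀ {i j} → cycle-vertex i ≡ cycle-vertex j → i ≡ j
  cycle-vertex-injective eq = ≤-antisym
    (≮⇒≥ λ j<i → <-irrefl (sym eq) (cycle-vertex-strictMono j<i))
    (≮⇒≥ λ i<j → <-irrefl eq (cycle-vertex-strictMono i<j))

  cycle-vertex-step-below : ∀ {i} → i < k → cycle-vertex (suc i) ≡ cycle-vertex i + m
  cycle-vertex-step-below {i} i<k = begin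
    suc i + 2 * k * (suc i ⊓ k)   ≡⟨ cong (λ x → suc i + 2 * k * x) (m≤n⇒m⊓n≡m i<k) ⟩
    suc i + 2 * k * suc i         ≡⟨ advance i k ⟩
    i + 2 * k * i + m             ≡⟨ cong (λ x → i + 2 * k * x + m) (m≤n⇒m⊓n≡m (<⇒≤ i<k)) ⟨
    i + 2 * k * (i ⊓ k) + m       ∎
    where
    open ≡-Reasoning
    advance : ∀ i k → suc i + 2 * k * suc i ≡ i + 2 * k * i + (2 * k + 1)
    advance = solve-∀

  cycle-vertex-step-above : ∀ {i} → k ≤ i → cycle-vertex (suc i) ≡ cycle-vertex i + 1
  cycle-vertex-step-above {i} k≤i = begin
    suc i + 2 * k * (suc i ⊓ k)   ≡⟨ cong (λ x → suc i + 2 * k * x) (m≥n⇒m⊓n≡n (m≤n⇒m≤1+n k≤i)) ⟩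
    suc i + 2 * k * k             ≡⟨ +-comm 1 (i + 2 * k * k) ⟩
    i + 2 * k * k + 1             ≡⟨ cong (λ x → i + 2 * k * x + 1) (m≥n⇒m⊓n≡n k≤i) ⟨
    i + 2 * k * (i ⊓ k) + 1       ∎
    where open ≡-Reasoning

  cycle-vertex-last : cycle-vertex m ≡ n
  cycle-vertex-last = begin
    m + 2 * k * (m ⊓ k)   ≡⟨ cong (λ x → m + 2 * k * x) (m≥n⇒m⊓n≡n (m≤n⇒m≤n+o 1 (m≤n*m k 2))) ⟩
    m + 2 * k * k         ≡⟨ closes k ⟩
    n                     ∎
    where
    open ≡-Reasoning
    closes : ∀ k → 2 * k + 1 + 2 * k * k ≡ suc (2 * k * k + 2 * k)
    closes = solve-∀

  cycle-step-generator : ∀ i → ∃ λ c → c ∈ extGens k × cycle-vertex i + c ≡ cycle-vertex (suc i)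
  cycle-step-generator i with i <? k
  ... | yes i<k = m , there (there (here refl)) , sym (cycle-vertex-step-below i<k)
  ... | no i≮k  = 1 , here refl , sym (cycle-vertex-step-above (≮⇒≥ i≮k))

  cycle : ℕ → Fin n
  cycle i = cycle-vertex i mod n

  toℕ-cycle : ∀ i → toℕ (cycle i) ≡ cycle-vertex i % n
  toℕ-cycle i = toℕ-fromℕ< _

  cycle-adjacent : ∀ i → ExtAdj k (cycle i) (cycle (suc i))
  cycle-adjacent i with cycle-step-generator i
  ... | c , c∈ , step = c , c∈ , (begin
    (toℕ (cycle i) + c) % n         ≡⟨ %-+-cong {n} {toℕ (cycle i)} {cycle-vertex i} {c}
                                         (trans (cong (_% n) (toℕ-cycle i)) (m%n%n≡m%n (cycle-vertex i) n)) refl ⟩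
    (cycle-vertex i + c) % n        ≡⟨ cong (_% n) step ⟩
    cycle-vertex (suc i) % n        ≡⟨ toℕ-cycle (suc i) ⟨
    toℕ (cycle (suc i))             ∎)
    where open ≡-Reasoning

  toℕ-cycle-below : ∀ {i} → i < m → toℕ (cycle i) ≡ cycle-vertex i
  toℕ-cycle-below {i} i<m = trans (toℕ-cycle i)
    (m<n⇒m%n≡m (<-≤-trans (cycle-vertex-strictMono i<m) (≤-reflexive cycle-vertex-last)))

  odd-cycle : 1 ≤ k → IsCycle (ExtAdj k) m cycle
  odd-cycle 1≤k = +-monoˡ-≤ 1 (*-monoʳ-≤ 2 1≤k) , closed , (λ i _ → cycle-adjacent i) , distinct
    where
    closed : cycle m ≡ cycle 0
    closed = toℕ-injective (begin
      toℕ (cycle m)           ≡⟨ toℕ-cycle m ⟩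
      cycle-vertex m % n      ≡⟨ cong (_% n) cycle-vertex-last ⟩
      n % n                   ≡⟨ n%n≡0 n ⟩
      0                       ≡⟨ cong (_% n) (*-zeroʳ (2 * k)) ⟨
      cycle-vertex 0 % n      ≡⟨ toℕ-cycle 0 ⟨
      toℕ (cycle 0)           ∎)
      where open ≡-Reasoning
    distinct : ∀ i j → i < m → j < m → cycle i ≡ cycle j → i ≡ j
    distinct i j i<m j<m eq = cycle-vertex-injective
      (trans (sym (toℕ-cycle-below i<m)) (trans (cong toℕ eq) (toℕ-cycle-below j<m)))

theorem8 : (k : ℕ) → 1 ≤ k → OddGirth (ExtAdj k) (2 * k + 1)
theorem8 k 1≤k = ((k , +-comm (2 * k) 1) , cycle k , odd-cycle k 1≤k) , λ _ _ → odd-cycle-long k
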